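{- Let $n\ge3$, $p\in[1,2n-2]$ and $\gamma,\delta\in P(n-2,n)$ with $|\delta|=|\gamma|+p$. If $|\delta|\le 2n-3$ or $|\gamma|>2n-3$, then $\gamma\to\delta$ implies $\gamma\subseteq\delta$; that is, $\delta$ is obtained from $\gamma$ without removing any box of $\gamma$.
   Context: $P(n-2,n)$ is the set of partitions $\gamma=(\gamma_1,\gamma_2)$ inside a $2\times(2n-2)$ rectangle that are $(n-2)$-strict ($\gamma_1>\gamma_2$ whenever $\gamma_1>n-2$). Boxes are $(r:c)$ (row $r$, column $c$). $(r:c)$ is related to $(r':c')$ if $|c-(n-1)|+r=|c'-(n-1)|+r'$. The relation $\gamma\to\delta$ holds if $\delta$ can be obtained from $\gamma$ by removing a vertical strip (at most one box per row) from the first $n-2$ columns of $\gamma$ and then adding a horizontal strip (at most one box per column), such that (1) each box of $\gamma$ in the first $n-2$ columns having no box of $\delta$ below it is related to at most one box of $\delta\setminus\gamma$; and (2) every box of $\gamma\setminus\delta$, and the box above it, is each related to exactly one box of $\delta\setminus\gamma$, and these boxes of $\delta\setminus\gamma$ all lie in the same row. -}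

module Defs where

open import Data.Nat using (ℕ; zero; suc; _+_; _*_; _∸_; _≤_; _<_; ∣_-_∣)
open import Data.Product using (_×_; _,_; proj₁; proj₂; Σ; ∃)
open import Data.Empty using (⊥)
open import Relation.Nullary using (¬_)
open import Relation.Binary.PropositionalEquality using (_≡_)

-- A two-row partition γ = (γ₁ , γ₂) is a pair of naturals.
Part : Set
Part = ℕ × ℕ

-- A box (r : c) is a pair (row r, column c), rows and columns 1-based.
Box : Set
Box = ℕ × ℕ

rowLen : Part → ℕ → ℕ
rowLen γ 1 = proj₁ γ
rowLen γ 2 = proj₂ γ
rowLen γ _ = 0

_∈ᵇ_ : Box → Part → Set
(r , c) ∈ᵇ γ = (1 ≤ c) × (c ≤ rowLen γ r)

∣_∣ : Part → ℕ
∣ γ ∣ = proj₁ γ + proj₂ γ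

_⊆ᵖ_ : Part → Part → Set
γ ⊆ᵖ δ = ∀ b → b ∈ᵇ γ → b ∈ᵇ δ

InP : ℕ → Part → Set
InP n (g₁ , g₂) = (g₂ ≤ g₁) × (g₁ ≤ 2 * n ∸ 2) × (n ∸ 2 < g₁ → g₂ < g₁)

Related : ℕ → Box → Box → Set
Related n (r , c) (r' , c') = ∣ c - (n ∸ 1) ∣ + r ≡ ∣ c' - (n ∸ 1) ∣ + r'

_∈_∖_ : Box → Part → Part → Set
b ∈ δ ∖ γ = (b ∈ᵇ δ) × ¬ (b ∈ᵇ γ)

AtMostOneRel : ℕ → Part → Part → Box → Set
AtMostOneRel n γ δ x =
  ∀ b b' → b ∈ δ ∖ γ → Related n x b → b' ∈ δ ∖ γ → Related n x b' → b ≡ b'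

ExactlyOneRelInRow : ℕ → Part → Part → ℕ → Box → Set
ExactlyOneRelInRow n γ δ R x =
  Σ Box (λ b → (b ∈ δ ∖ γ) × Related n x b × (proj₁ b ≡ R)
         × (∀ b' → b' ∈ δ ∖ γ → Related n x b' → b' ≡ b))

-- box directly below (r:c) is (r+1:c); box above (r:c) is (r-1:c).
-- The relation γ → δ.
--   μ : the partition obtained after removing the vertical strip,
--   δ is then obtained from μ by adding a horizontal strip.
Arrow : ℕ → Part → Part → Set
Arrow n γ δ = Σ Part λ μ →
  let (m₁ , m₂) = μ ; (g₁ , g₂) = γ ; (d₁ , d₂) = δ in
  (m₂ ≤ m₁)
  -- γ / μ is a vertical strip (≤ one box per row) in the first n-2 columns
  × (m₁ ≤ g₁) × (g₁ ≤ suc m₁) × (m₂ ≤ g₂) × (g₂ ≤ suc m₂)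
  × (m₁ < g₁ → g₁ ≤ n ∸ 2) × (m₂ < g₂ → g₂ ≤ n ∸ 2)
  -- δ / μ is a horizontal strip (≤ one box per column)
  × (m₁ ≤ d₁) × (m₂ ≤ d₂) × (d₂ ≤ m₁)
  × (∀ r c → (r , c) ∈ᵇ γ → c ≤ n ∸ 2 → ¬ ((suc r , c) ∈ᵇ δ)
       → AtMostOneRel n γ δ (r , c))
  × Σ ℕ (λ R →
      ∀ r c → (r , c) ∈ γ ∖ δ →
        ExactlyOneRelInRow n γ δ R (r , c)
        × (2 ≤ r → ExactlyOneRelInRow n γ δ R (r ∸ 1 , c)))

module Submission where

-- Write K = n-1 for the axis column of the relation: (r:c) and (r':c')
-- are related iff |c-K| + r = |c'-K| + r'.  The removed vertical strip
-- lives in the first n-2 columns, so a removed box (r:g) has g ≤ K.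
-- The key geometric fact (related-reflected) is that a box (r':c) with
-- c > g and r' ≤ r related to such a box must be its mirror image
-- across the axis: g + c + r' = 2K + r.
--
-- Row 1 cannot shrink: condition (2) would give a partner of its last
-- box in row 2 strictly left of it, contradicting the mirror identity.
-- Row 2 cannot shrink: the partners of its last box (2:g₂) and of the
-- box (1:g₂) above it both lie in row 1; their mirror identities force
-- |γ| < 2K ≤ |δ|, exactly the straddling that the hypothesis excludes.

open import Defs
open import Data.Nat using (ℕ; suc; _+_; _*_; _∸_; _≤_; _<_; ∣_-_∣; z≤n; s≤s; s≤s⁻¹; _≤?_)
open import Data.Nat.Properties
open import Data.Nat.Tactic.RingSolver using (solve-∀)
open import Data.Product using (_×_; _,_; proj₁; proj₂)
open import Data.Sum using (_⊎_; inj₁; inj₂)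
open import Data.Empty using (⊥; ⊥-elim)
open import Relation.Nullary using (¬_; yes; no)
open import Relation.Binary.PropositionalEquality using (_≡_; refl; sym; trans; cong; cong₂; module ≡-Reasoning)

⊆ᵖ-rowwise : ∀ {g₁ g₂ d₁ d₂} → g₁ ≤ d₁ → g₂ ≤ d₂ → (g₁ , g₂) ⊆ᵖ (d₁ , d₂)
⊆ᵖ-rowwise _     _     (0 , _)                 (1≤c , c≤0)  = ⊥-elim (<⇒≱ 1≤c c≤0)
⊆ᵖ-rowwise g₁≤d₁ _     (1 , _)                 (1≤c , c≤g₁) = 1≤c , ≤-trans c≤g₁ g₁≤d₁
⊆ᵖ-rowwise _     g₂≤d₂ (2 , _)                 (1≤c , c≤g₂) = 1≤c , ≤-trans c≤g₂ g₂≤d₂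
⊆ᵖ-rowwise _     _     (suc (suc (suc _)) , _) (1≤c , c≤0)  = ⊥-elim (<⇒≱ 1≤c c≤0)

module Transition (γ δ : Part) where

  lastBox-removed : ∀ r → rowLen δ r < rowLen γ r → (r , rowLen γ r) ∈ γ ∖ δ
  lastBox-removed r δr<γr =
    (≤-trans (s≤s z≤n) δr<γr , ≤-refl) , λ box∈δ → <⇒≱ δr<γr (proj₂ box∈δ)

  ∖-beyond : ∀ r {c} → (r , c) ∈ δ ∖ γ → rowLen γ r < c × c ≤ rowLen δ r
  ∖-beyond _ ((1≤c , c≤δr) , c∉γ) = ≰⇒> (λ c≤γr → c∉γ (1≤c , c≤γr)) , c≤δr

  ∖-inRows : ∀ r {c} → (r , c) ∈ δ ∖ γ → r ≡ 1 ⊎ r ≡ 2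
  ∖-inRows 0 new = ⊥-elim (<⇒≱ (proj₁ (∖-beyond 0 new)) (proj₂ (∖-beyond 0 new)))
  ∖-inRows 1 _ = inj₁ refl
  ∖-inRows 2 _ = inj₂ refl
  ∖-inRows r@(suc (suc (suc _))) new =
    ⊥-elim (<⇒≱ (proj₁ (∖-beyond r new)) (proj₂ (∖-beyond r new)))

  inFirstRow : ∀ r {c} → rowLen δ 2 < rowLen γ 2 → (r , c) ∈ δ ∖ γ → r ≡ 1
  inFirstRow r δ₂<γ₂ new with ∖-inRows r new
  ... | inj₁ r≡1 = r≡1
  ... | inj₂ refl =
    ⊥-elim (<-asym δ₂<γ₂ (<-≤-trans (proj₁ (∖-beyond 2 new)) (proj₂ (∖-beyond 2 new))))

dist-left : ∀ {c K} → c ≤ K → ∣ c - K ∣ + c ≡ K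
dist-left c≤K = trans (cong (_+ _) (m≤n⇒∣m-n∣≡n∸m c≤K)) (m∸n+n≡m c≤K)

dist-right : ∀ {c K} → K ≤ c → ∣ c - K ∣ + K ≡ c
dist-right K≤c = trans (cong (_+ _) (m≤n⇒∣n-m∣≡n∸m K≤c)) (m∸n+n≡m K≤c)

interchange : ∀ a b c d → (a + b) + (c + d) ≡ (a + c) + (b + d)
interchange = solve-∀

regroup : ∀ a b c d → a + (b + c) + d ≡ (a + c) + (b + d)
regroup = solve-∀

regroup′ : ∀ a b c d → (a + b) + (c + d) ≡ c + a + b + d
regroup′ = solve-∀

-- A box (r':c) related to a box (r:g) with g ≤ K, lying strictly to its
-- right and not below it, is its reflection across the axis column K.
-- (On the same side of the axis, related boxes satisfy c - r = g - r',
-- which c > g and r' ≤ r forbid.)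
related-reflected : ∀ K {r g r' c} → g ≤ K → g < c → r' ≤ r →
  ∣ g - K ∣ + r ≡ ∣ c - K ∣ + r' → g + c + r' ≡ K + K + r
related-reflected K {r} {g} {r'} {c} g≤K g<c r'≤r rel with ≤-total c K
... | inj₁ c≤K = ⊥-elim (<-irrefl sameDiagonal (+-mono-<-≤ g<c r'≤r))
  where
  open ≡-Reasoning
  x y : ℕ
  x = ∣ g - K ∣
  y = ∣ c - K ∣
  sameDiagonal : g + r' ≡ c + r
  sameDiagonal = +-cancelˡ-≡ (x + y) _ _ (begin
    (x + y) + (g + r') ≡⟨ interchange x y g r' ⟩
    (x + g) + (y + r') ≡⟨ cong₂ _+_ (trans (dist-left g≤K) (sym (dist-left c≤K))) (sym rel) ⟩
    (y + c) + (x + r) ≡⟨ interchange y c x r ⟩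
    (y + x) + (c + r) ≡⟨ cong (_+ (c + r)) (+-comm y x) ⟩
    (x + y) + (c + r) ∎)
... | inj₂ K≤c = begin
  g + c + r'                   ≡⟨ cong (λ z → g + z + r') (sym (dist-right K≤c)) ⟩
  g + (∣ c - K ∣ + K) + r'     ≡⟨ regroup g ∣ c - K ∣ K r' ⟩
  (g + K) + (∣ c - K ∣ + r')   ≡⟨ cong ((g + K) +_) (sym rel) ⟩
  (g + K) + (∣ g - K ∣ + r)    ≡⟨ regroup′ g K ∣ g - K ∣ r ⟩
  ∣ g - K ∣ + g + K + r        ≡⟨ cong (λ z → z + K + r) (dist-left g≤K) ⟩
  K + K + r                    ∎
  where open ≡-Reasoning

removed-left-of-axis : ∀ n {m g} → (m < g → g ≤ n ∸ 2) → m < g → g ≤ n ∸ 1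
removed-left-of-axis n strip m<g = ≤-trans (strip m<g) (∸-monoʳ-≤ n (s≤s z≤n))

-- The first row never shrinks along γ → δ: the partner in δ ∖ γ that
-- condition (2) assigns to the removed box (1:g₁) would have to sit in
-- row 2 strictly left of g₁, which related-reflected rules out.
firstRow-kept : ∀ n {γ δ} → Arrow n γ δ → rowLen γ 1 ≤ rowLen δ 1
firstRow-kept n {g₁ , g₂} {d₁ , d₂}
  ((m₁ , _) , _ , _ , _ , _ , _ , strip₁ , _ , m₁≤d₁ , _ , d₂≤m₁ , _ , R , cond₂)
  with g₁ ≤? d₁
... | yes g₁≤d₁ = g₁≤d₁
... | no g₁≰d₁ = ⊥-elim (noPartner (proj₁ (cond₂ 1 g₁ (lastBox-removed 1 d₁<g₁))))
  where
  open Transition (g₁ , g₂) (d₁ , d₂)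
  K : ℕ
  K = n ∸ 1
  d₁<g₁ : d₁ < g₁
  d₁<g₁ = ≰⇒> g₁≰d₁
  m₁<g₁ : m₁ < g₁
  m₁<g₁ = ≤-<-trans m₁≤d₁ d₁<g₁
  g₁≤K : g₁ ≤ K
  g₁≤K = removed-left-of-axis n strip₁ m₁<g₁
  noPartner : ExactlyOneRelInRow n (g₁ , g₂) (d₁ , d₂) R (1 , g₁) → ⊥
  noPartner ((r , c) , new , rel , _) with ∖-inRows r new
  ... | inj₁ refl =
    g₁≰d₁ (<⇒≤ (<-≤-trans (proj₁ (∖-beyond 1 new)) (proj₂ (∖-beyond 1 new))))
  ... | inj₂ refl =
    <-irrefl (related-reflected K c≤K c<g₁ (s≤s z≤n) (sym rel))
             (+-mono-<-≤ (+-mono-<-≤ (<-≤-trans c<g₁ g₁≤K) g₁≤K) (s≤s z≤n))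
    where
    c<g₁ : c < g₁
    c<g₁ = ≤-<-trans (≤-trans (proj₂ (∖-beyond 2 new)) d₂≤m₁) m₁<g₁
    c≤K : c ≤ K
    c≤K = <⇒≤ (<-≤-trans c<g₁ g₁≤K)

-- If the second row shrinks along γ → δ, the sizes straddle 2(n-1):
-- the partners of (2:g₂) and (1:g₂) lie in row 1 beyond g₁, and their
-- mirror identities give |γ| < 2(n-1) ≤ |δ|.
secondRow-shrinks : ∀ n {g₁ g₂ d₁ d₂} → g₂ ≤ g₁ → Arrow n (g₁ , g₂) (d₁ , d₂) →
  d₂ < g₂ → (g₁ + g₂ < (n ∸ 1) + (n ∸ 1)) × ((n ∸ 1) + (n ∸ 1) ≤ d₁ + d₂)
secondRow-shrinks n {g₁} {g₂} {d₁} {d₂} g₂≤g₁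
  (_ , _ , _ , _ , _ , g₂≤1+m₂ , _ , strip₂ , _ , m₂≤d₂ , _ , _ , R , cond₂) d₂<g₂ =
  let (below , above) = cond₂ 2 g₂ (lastBox-removed 2 d₂<g₂)
  in γ-small (above (s≤s (s≤s z≤n))) , δ-large below
  where
  open Transition (g₁ , g₂) (d₁ , d₂)
  K : ℕ
  K = n ∸ 1
  g₂≤K : g₂ ≤ K
  g₂≤K = removed-left-of-axis n strip₂ (≤-<-trans m₂≤d₂ d₂<g₂)

  -- The partner (1:c′) of (1:g₂) is its mirror image: g₂ + c′ = 2K > |γ|.
  γ-small : ExactlyOneRelInRow n (g₁ , g₂) (d₁ , d₂) R (1 , g₂) → g₁ + g₂ < K + K
  γ-small ((r′ , c′) , new′ , rel′ , _) with inFirstRow r′ d₂<g₂ new′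
  ... | refl = begin-strict
    g₁ + g₂ ≡⟨ +-comm g₁ g₂ ⟩
    g₂ + g₁ <⟨ +-monoʳ-< g₂ g₁<c′ ⟩
    g₂ + c′ ≡⟨ +-cancelʳ-≡ 1 _ _ (related-reflected K g₂≤K (≤-<-trans g₂≤g₁ g₁<c′) ≤-refl rel′) ⟩
    K + K   ∎
    where
    open ≤-Reasoning
    g₁<c′ : g₁ < c′
    g₁<c′ = proj₁ (∖-beyond 1 new′)

  -- The partner (1:c) of (2:g₂) satisfies g₂ + c = 2K + 1, and both
  -- c ≤ d₁ and g₂ ≤ d₂ + 1, so |δ| ≥ 2K.
  δ-large : ExactlyOneRelInRow n (g₁ , g₂) (d₁ , d₂) R (2 , g₂) → K + K ≤ d₁ + d₂
  δ-large ((r , c) , new , rel , _) with inFirstRow r d₂<g₂ new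
  ... | refl = +-cancelʳ-≤ 2 _ _ (begin
    K + K + 2         ≡⟨ sym (related-reflected K g₂≤K (≤-<-trans g₂≤g₁ g₁<c) (s≤s z≤n) rel) ⟩
    g₂ + c + 1        ≤⟨ +-monoˡ-≤ 1 (+-mono-≤ (≤-trans g₂≤1+m₂ (s≤s m₂≤d₂)) c≤d₁) ⟩
    suc d₂ + d₁ + 1   ≡⟨ shift d₂ d₁ ⟩
    d₁ + d₂ + 2       ∎)
    where
    open ≤-Reasoning
    g₁<c : g₁ < c
    g₁<c = proj₁ (∖-beyond 1 new)
    c≤d₁ : c ≤ d₁
    c≤d₁ = proj₂ (∖-beyond 1 new)
    shift : ∀ a b → suc a + b + 1 ≡ b + a + 2
    shift = solve-∀

twice-axis : ∀ n → 2 ≤ n → suc (2 * n ∸ 3) ≡ (n ∸ 1) + (n ∸ 1)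
twice-axis 1 (s≤s ())
twice-axis (suc (suc m)) _ rewrite +-identityʳ m | +-suc m (suc m) = refl

no-straddle : ∀ {t s a b} → suc t ≡ s → a < s → s ≤ b → ¬ (b ≤ t ⊎ t < a)
no-straddle refl _   s≤b (inj₁ b≤t) = ≤⇒≯ b≤t s≤b
no-straddle refl a<s _   (inj₂ t<a) = ≤⇒≯ (s≤s⁻¹ a<s) t<a

lemma4p5 : (n p : ℕ) → 3 ≤ n → 1 ≤ p → p ≤ 2 * n ∸ 2 →
    (γ δ : Part) → InP n γ → InP n δ → ∣ δ ∣ ≡ ∣ γ ∣ + p →
    (∣ δ ∣ ≤ 2 * n ∸ 3 ⊎ 2 * n ∸ 3 < ∣ γ ∣) →
    Arrow n γ δ → γ ⊆ᵖ δ
lemma4p5 n _ 3≤n _ _ (g₁ , g₂) (d₁ , d₂) (g₂≤g₁ , _) _ _ sizes arrow =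
  ⊆ᵖ-rowwise (firstRow-kept n arrow) secondRow-kept
  where
  secondRow-kept : g₂ ≤ d₂
  secondRow-kept with g₂ ≤? d₂
  ... | yes g₂≤d₂ = g₂≤d₂
  ... | no g₂≰d₂ =
    let (γ-small , δ-large) = secondRow-shrinks n g₂≤g₁ arrow (≰⇒> g₂≰d₂)
    in ⊥-elim (no-straddle (twice-axis n (<⇒≤ 3≤n)) γ-small δ-large sizes)
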